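{- If $S \subsetneq \mathbb{Z}^2$ is B-stable, then $|S \cap [6]^2| \le 9$, where $[6] = \{1,2,3,4,5,6\}$.
   Context: A lattice triangle is the convex hull in $\mathbb{R}^2$ of three non-collinear points of $\mathbb{Z}^2$. A triangle is a set $T = \Delta \cap \mathbb{Z}^2$ for a lattice triangle $\Delta$. A border triangle is a triangle containing exactly $4$ points of $\mathbb{Z}^2$ whose non-vertex point lies on the boundary of $\Delta$. A set $S \subseteq \mathbb{Z}^2$ is B-stable if no border triangle has exactly three of its points in $S$. -}

module Defs where

open import Data.Bool using (Bool; true; false; if_then_else_)
open import Data.Nat using (ℕ)
import Data.Nat as N
open import Data.Integer using (ℤ; +_; _-_; _*_; _≤_; 0ℤ)
open import Data.Product using (_×_; _,_; Σ; ∃; ∃-syntax)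
open import Data.Sum using (_⊎_)
open import Data.List using (List; []; _∷_; map; concatMap)
open import Relation.Binary.PropositionalEquality using (_≡_; _≢_)

Point : Set
Point = ℤ × ℤ

Subset : Set
Subset = Point → Bool

-- det(q - p, r - p): twice the signed area of the triangle p q r.
orient : Point → Point → Point → ℤ
orient (px , py) (qx , qy) (rx , ry) = (qx - px) * (ry - py) - (qy - py) * (rx - px)

NonCollinear : Point → Point → Point → Set
NonCollinear a b c = orient a b c ≢ 0ℤ

-- p lies in the (closed) convex hull of a, b, c (for non-collinear a, b, c):
-- all barycentric numerators have the sign of the orientation (or vanish).
InHull : Point → Point → Point → Point → Set
InHull a b c p =
  (0ℤ ≤ orient p b c * orient a b c) ×
  (0ℤ ≤ orient a p c * orient a b c) ×
  (0ℤ ≤ orient a b p * orient a b c)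

-- p lies on the boundary of conv{a,b,c} (given that it lies in it):
-- one barycentric coordinate vanishes.
OnBoundary : Point → Point → Point → Point → Set
OnBoundary a b c p = (orient p b c ≡ 0ℤ) ⊎ (orient a p c ≡ 0ℤ) ⊎ (orient a b p ≡ 0ℤ)

IsBorderTriangle : Point → Point → Point → Point → Set
IsBorderTriangle a b c d =
  NonCollinear a b c ×
  d ≢ a × d ≢ b × d ≢ c ×
  InHull a b c d ×
  OnBoundary a b c d ×
  (∀ p → InHull a b c p → (p ≡ a) ⊎ (p ≡ b) ⊎ (p ≡ c) ⊎ (p ≡ d))

countIn : Subset → List Point → ℕ
countIn S [] = 0
countIn S (p ∷ ps) = if S p then N.suc (countIn S ps) else countIn S ps

BStable : Subset → Set
BStable S = ∀ a b c d → IsBorderTriangle a b c d → countIn S (a ∷ b ∷ c ∷ d ∷ []) ≢ 3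

Proper : Subset → Set
Proper S = ∃[ p ] S p ≡ false

range6 : List ℤ
range6 = + 1 ∷ + 2 ∷ + 3 ∷ + 4 ∷ + 5 ∷ + 6 ∷ []

grid6 : List Point
grid6 = concatMap (λ x → map (λ y → (x , y)) range6) range6

-- B-stability is invariant under unimodular affine maps of ℤ², and such a map
-- sends the border triangle (0,0), (2,0), (0,1) with border point (1,0) to
-- o, o+2u, o+v with border point o+u whenever det(u,v) = ±1. A B-stable set
-- containing three of these four points therefore contains the fourth, hence
-- the unimodular triangle o, o+u, o+v, and sliding a unimodular triangle along
-- border triangles fills all of ℤ². So a proper B-stable set contains no such
-- triple, and a branch-and-bound (Russian-doll) search shows that at most 9
-- points of [6]² avoid all of them.
module Submission where

open import Defs
open import Data.Bool using (Bool; true; false; T; _∧_; _∨_; if_then_else_)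
open import Data.Bool.Properties using (T-∨; T-∧; T-≡; not-¬)
open import Data.Empty using (⊥; ⊥-elim)
open import Data.Integer as ℤ
  using (ℤ; +_; -[1+_]; _+_; _-_; _*_; _/_; _≤_; 0ℤ; 1ℤ; -1ℤ; +≤+)
open import Data.Integer.Properties
  using (*-cancelʳ-≤-pos; 0≤i-j⇒j≤i; *-assoc; *-identityˡ; *-zeroʳ)
open import Data.Integer.Tactic.RingSolver using (solve-∀)
open import Data.List using (List; []; _∷_; length; map; foldr)
open import Data.List.Properties using (map-cong)
open import Data.List.Relation.Unary.All as All using (All; []; _∷_)
open import Data.List.Relation.Unary.All.Properties using (All¬⇒¬Any)
open import Data.List.Relation.Unary.Any using (Any; any?; satisfied)
import Data.Nat as ℕ
open import Data.Nat using (ℕ; zero; suc; z≤n; s≤s; _≤ᵇ_)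
open import Data.Nat.Properties
  using (≤ᵇ⇒≤; +-suc; +-monoʳ-≤; m≤n⇒m≤1+n; +-identityʳ; ≤-trans)
open import Data.Product using (_×_; _,_; ∃; proj₁)
open import Data.Product.Properties using (≡-dec)
open import Data.Sum using (_⊎_; inj₁; inj₂)
import Data.Sum as Sum
open import Data.Unit using (⊤; tt)
open import Function using (_∘_; id)
open import Function.Bundles using (Equivalence)
open import Relation.Nullary using (Dec; isYes; ¬_; no; _×-dec_; _⊎-dec_)
open import Relation.Nullary.Decidable using (toWitness)
open import Relation.Binary.PropositionalEquality
  using (_≡_; refl; sym; trans; cong; cong₂; subst; module ≡-Reasoning)

infixl 6 _⊕_ _⊖_
infixr 7 _·_

_⊕_ _⊖_ : Point → Point → Point
(a₁ , a₂) ⊕ (b₁ , b₂) = a₁ + b₁ , a₂ + b₂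
(a₁ , a₂) ⊖ (b₁ , b₂) = a₁ - b₁ , a₂ - b₂

_·_ : ℤ → Point → Point
k · (a₁ , a₂) = k * a₁ , k * a₂

det : Point → Point → ℤ
det (a₁ , a₂) (b₁ , b₂) = a₁ * b₂ - a₂ * b₁

Unimodular : Point → Point → Set
Unimodular u v = det u v * det u v ≡ 1ℤ

linear : Point → Point → Point → Point
linear u v (s , t) = s · u ⊕ t · v

affine : Point → Point → Point → Point → Point
affine o u v p = o ⊕ linear u v p

cramer : Point → Point → Point → Point
cramer u v x = det x v , det u x

det-linear : ∀ u v x y → det (linear u v x) (linear u v y) ≡ det u v * det x y
det-linear (u₁ , u₂) (v₁ , v₂) (x₁ , x₂) (y₁ , y₂) = identity u₁ u₂ v₁ v₂ x₁ x₂ y₁ y₂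
  where
  identity : ∀ u₁ u₂ v₁ v₂ x₁ x₂ y₁ y₂ →
    (x₁ * u₁ + x₂ * v₁) * (y₁ * u₂ + y₂ * v₂) - (x₁ * u₂ + x₂ * v₂) * (y₁ * u₁ + y₂ * v₁)
      ≡ (u₁ * v₂ - u₂ * v₁) * (x₁ * y₂ - x₂ * y₁)
  identity = solve-∀

linear-cramer : ∀ u v x → linear u v (cramer u v x) ≡ det u v · x
linear-cramer (u₁ , u₂) (v₁ , v₂) (x₁ , x₂) =
  cong₂ _,_ (component₁ u₁ u₂ v₁ v₂ x₁ x₂) (component₂ u₁ u₂ v₁ v₂ x₁ x₂)
  where
  component₁ : ∀ u₁ u₂ v₁ v₂ x₁ x₂ →
    (x₁ * v₂ - x₂ * v₁) * u₁ + (u₁ * x₂ - u₂ * x₁) * v₁ ≡ (u₁ * v₂ - u₂ * v₁) * x₁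
  component₁ = solve-∀
  component₂ : ∀ u₁ u₂ v₁ v₂ x₁ x₂ →
    (x₁ * v₂ - x₂ * v₁) * u₂ + (u₁ * x₂ - u₂ * x₁) * v₂ ≡ (u₁ * v₂ - u₂ * v₁) * x₂
  component₂ = solve-∀

cramer-linear : ∀ u v x → cramer u v (linear u v x) ≡ det u v · x
cramer-linear (u₁ , u₂) (v₁ , v₂) (x₁ , x₂) =
  cong₂ _,_ (component₁ u₁ u₂ v₁ v₂ x₁ x₂) (component₂ u₁ u₂ v₁ v₂ x₁ x₂)
  where
  component₁ : ∀ u₁ u₂ v₁ v₂ x₁ x₂ →
    (x₁ * u₁ + x₂ * v₁) * v₂ - (x₁ * u₂ + x₂ * v₂) * v₁ ≡ (u₁ * v₂ - u₂ * v₁) * x₁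
  component₁ = solve-∀
  component₂ : ∀ u₁ u₂ v₁ v₂ x₁ x₂ →
    u₁ * (x₁ * u₂ + x₂ * v₂) - u₂ * (x₁ * u₁ + x₂ * v₁) ≡ (u₁ * v₂ - u₂ * v₁) * x₂
  component₂ = solve-∀

linear-· : ∀ u v k x → linear u v (k · x) ≡ k · linear u v x
linear-· (u₁ , u₂) (v₁ , v₂) k (x₁ , x₂) =
  cong₂ _,_ (identity k x₁ x₂ u₁ v₁) (identity k x₁ x₂ u₂ v₂)
  where
  identity : ∀ k s t a b → (k * s) * a + (k * t) * b ≡ k * (s * a + t * b)
  identity = solve-∀

affine-⊖ : ∀ o u v p q → affine o u v q ⊖ affine o u v p ≡ linear u v (q ⊖ p)
affine-⊖ (o₁ , o₂) (u₁ , u₂) (v₁ , v₂) (p₁ , p₂) (q₁ , q₂) =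
  cong₂ _,_ (identity o₁ u₁ v₁ p₁ p₂ q₁ q₂) (identity o₂ u₂ v₂ p₁ p₂ q₁ q₂)
  where
  identity : ∀ o a b p₁ p₂ q₁ q₂ →
    (o + (q₁ * a + q₂ * b)) - (o + (p₁ * a + p₂ * b)) ≡ (q₁ - p₁) * a + (q₂ - p₂) * b
  identity = solve-∀

o⊕x⊖o≡x : ∀ o x → (o ⊕ x) ⊖ o ≡ x
o⊕x⊖o≡x (o₁ , o₂) (x₁ , x₂) = cong₂ _,_ (identity o₁ x₁) (identity o₂ x₂)
  where
  identity : ∀ o x → (o + x) - o ≡ x
  identity = solve-∀

o⊕[p⊖o]≡p : ∀ o p → o ⊕ (p ⊖ o) ≡ p
o⊕[p⊖o]≡p (o₁ , o₂) (p₁ , p₂) = cong₂ _,_ (identity o₁ p₁) (identity o₂ p₂)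
  where
  identity : ∀ o p → o + (p - o) ≡ p
  identity = solve-∀

·-assoc : ∀ k l x → k · l · x ≡ (k * l) · x
·-assoc k l (x₁ , x₂) = cong₂ _,_ (sym (*-assoc k l x₁)) (sym (*-assoc k l x₂))

·-identityˡ : ∀ x → 1ℤ · x ≡ x
·-identityˡ (x₁ , x₂) = cong₂ _,_ (*-identityˡ x₁) (*-identityˡ x₂)

orient-affine : ∀ o u v a b c →
  orient (affine o u v a) (affine o u v b) (affine o u v c) ≡ det u v * orient a b c
orient-affine o u v a b c = begin
  orient (φ a) (φ b) (φ c)                       ≡⟨⟩
  det (φ b ⊖ φ a) (φ c ⊖ φ a)                    ≡⟨ cong₂ det (affine-⊖ o u v a b) (affine-⊖ o u v a c) ⟩
  det (linear u v (b ⊖ a)) (linear u v (c ⊖ a))  ≡⟨ det-linear u v (b ⊖ a) (c ⊖ a) ⟩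
  det u v * det (b ⊖ a) (c ⊖ a)                  ∎
  where
  open ≡-Reasoning
  φ : Point → Point
  φ = affine o u v

module UnimodularAffine (o u v : Point) (unimodular : Unimodular u v) where

  φ : Point → Point
  φ = affine o u v

  coordinates : Point → Point
  coordinates p = det u v · cramer u v (p ⊖ o)

  det·det·x≡x : ∀ x → det u v · det u v · x ≡ x
  det·det·x≡x x = trans (·-assoc (det u v) (det u v) x) (trans (cong (_· x) unimodular) (·-identityˡ x))

  det*x≡0⇒x≡0 : ∀ {x} → det u v * x ≡ 0ℤ → x ≡ 0ℤ
  det*x≡0⇒x≡0 {x} e = begin
    x                       ≡⟨ sym (*-identityˡ x) ⟩
    1ℤ * x                  ≡⟨ cong (_* x) (sym unimodular) ⟩
    det u v * det u v * x   ≡⟨ *-assoc (det u v) (det u v) x ⟩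
    det u v * (det u v * x) ≡⟨ cong (det u v *_) e ⟩
    det u v * 0ℤ            ≡⟨ *-zeroʳ (det u v) ⟩
    0ℤ                      ∎
    where open ≡-Reasoning

  affine-coordinates : ∀ p → φ (coordinates p) ≡ p
  affine-coordinates p = begin
    φ (coordinates p)                             ≡⟨⟩
    o ⊕ linear u v (det u v · cramer u v (p ⊖ o)) ≡⟨ cong (o ⊕_) (linear-· u v (det u v) _) ⟩
    o ⊕ det u v · linear u v (cramer u v (p ⊖ o)) ≡⟨ cong (λ y → o ⊕ det u v · y) (linear-cramer u v _) ⟩
    o ⊕ det u v · det u v · (p ⊖ o)               ≡⟨ cong (o ⊕_) (det·det·x≡x _) ⟩
    o ⊕ (p ⊖ o)                                   ≡⟨ o⊕[p⊖o]≡p o p ⟩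
    p                                             ∎
    where open ≡-Reasoning

  coordinates-affine : ∀ q → coordinates (φ q) ≡ q
  coordinates-affine q = begin
    coordinates (φ q)                     ≡⟨⟩
    det u v · cramer u v (φ q ⊖ o)        ≡⟨ cong (λ y → det u v · cramer u v y) (o⊕x⊖o≡x o _) ⟩
    det u v · cramer u v (linear u v q)   ≡⟨ cong (det u v ·_) (cramer-linear u v q) ⟩
    det u v · det u v · q                 ≡⟨ det·det·x≡x q ⟩
    q                                     ∎
    where open ≡-Reasoning

  affine-injective : ∀ {p q} → φ p ≡ φ q → p ≡ q
  affine-injective {p} {q} e =
    trans (sym (coordinates-affine p)) (trans (cong coordinates e) (coordinates-affine q))

  orient*orient-affine : ∀ p q r a b c →
    orient (φ p) (φ q) (φ r) * orient (φ a) (φ b) (φ c) ≡ orient p q r * orient a b c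
  orient*orient-affine p q r a b c = begin
    orient (φ p) (φ q) (φ r) * orient (φ a) (φ b) (φ c)
      ≡⟨ cong₂ _*_ (orient-affine o u v p q r) (orient-affine o u v a b c) ⟩
    (det u v * orient p q r) * (det u v * orient a b c)
      ≡⟨ rearrange (det u v) (orient p q r) (orient a b c) ⟩
    (det u v * det u v) * (orient p q r * orient a b c)
      ≡⟨ cong (_* (orient p q r * orient a b c)) unimodular ⟩
    1ℤ * (orient p q r * orient a b c)
      ≡⟨ *-identityˡ _ ⟩
    orient p q r * orient a b c
      ∎
    where
    open ≡-Reasoning
    rearrange : ∀ d x y → (d * x) * (d * y) ≡ (d * d) * (x * y)
    rearrange = solve-∀

  inHull⁺ : ∀ {a b c p} → InHull a b c p → InHull (φ a) (φ b) (φ c) (φ p)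
  inHull⁺ {a} {b} {c} {p} (h₁ , h₂ , h₃) =
    subst (0ℤ ≤_) (sym (orient*orient-affine p b c a b c)) h₁ ,
    subst (0ℤ ≤_) (sym (orient*orient-affine a p c a b c)) h₂ ,
    subst (0ℤ ≤_) (sym (orient*orient-affine a b p a b c)) h₃

  inHull⁻ : ∀ {a b c p} → InHull (φ a) (φ b) (φ c) (φ p) → InHull a b c p
  inHull⁻ {a} {b} {c} {p} (h₁ , h₂ , h₃) =
    subst (0ℤ ≤_) (orient*orient-affine p b c a b c) h₁ ,
    subst (0ℤ ≤_) (orient*orient-affine a p c a b c) h₂ ,
    subst (0ℤ ≤_) (orient*orient-affine a b p a b c) h₃

  orient≡0-affine : ∀ {a b c} → orient a b c ≡ 0ℤ → orient (φ a) (φ b) (φ c) ≡ 0ℤ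
  orient≡0-affine {a} {b} {c} e =
    trans (orient-affine o u v a b c) (trans (cong (det u v *_) e) (*-zeroʳ (det u v)))

  isBorderTriangle⁺ : ∀ {a b c d} →
    IsBorderTriangle a b c d → IsBorderTriangle (φ a) (φ b) (φ c) (φ d)
  isBorderTriangle⁺ {a} {b} {c} {d} (noncollinear , d≢a , d≢b , d≢c , d-in , d-boundary , only) =
    noncollinear ∘ det*x≡0⇒x≡0 ∘ trans (sym (orient-affine o u v a b c)) ,
    d≢a ∘ affine-injective , d≢b ∘ affine-injective , d≢c ∘ affine-injective ,
    inHull⁺ {a} {b} {c} {d} d-in ,
    Sum.map (orient≡0-affine {d} {b} {c})
      (Sum.map (orient≡0-affine {a} {d} {c}) (orient≡0-affine {a} {b} {d})) d-boundary ,
    λ p p-in → Sum.map (preimage p) (Sum.map (preimage p) (Sum.map (preimage p) (preimage p)))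
      (only (coordinates p)
        (inHull⁻ {a} {b} {c} (subst (InHull (φ a) (φ b) (φ c)) (sym (affine-coordinates p)) p-in)))
    where
    preimage : ∀ p {q} → coordinates p ≡ q → p ≡ φ q
    preimage p e = trans (sym (affine-coordinates p)) (cong φ e)

  bStable-∘ : ∀ S (τ : Point → Point) → (∀ p → τ p ≡ φ p) → BStable S → BStable (S ∘ τ)
  bStable-∘ S τ τ≗φ stable a b c d border =
    stable (φ a) (φ b) (φ c) (φ d) (isBorderTriangle⁺ border)
      ∘ subst (_≡ 3) (cong (countIn S) (map-cong τ≗φ (a ∷ b ∷ c ∷ d ∷ [])))

standard-borderTriangle : IsBorderTriangle (0ℤ , 0ℤ) (+ 2 , 0ℤ) (0ℤ , 1ℤ) (1ℤ , 0ℤ)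
standard-borderTriangle =
  (λ ()) , (λ ()) , (λ ()) , (λ ()) , (+≤+ z≤n , +≤+ z≤n , +≤+ z≤n) , inj₂ (inj₂ refl) ,
  λ { (x , y) (h₁ , h₂ , h₃) →
      lattice-points x y
        (*-cancelʳ-≤-pos 0ℤ x (+ 2) (subst (0ℤ ≤_) (weight-b x y) h₂))
        (*-cancelʳ-≤-pos 0ℤ y (+ 4) (subst (0ℤ ≤_) (weight-c x y) h₃))
        (0≤i-j⇒j≤i (*-cancelʳ-≤-pos 0ℤ _ (+ 2) (subst (0ℤ ≤_) (weight-a x y) h₁))) }
  where
  weight-a : ∀ x y →
    ((+ 2 - x) * (1ℤ - y) - (0ℤ - y) * (0ℤ - x)) * + 2 ≡ (+ 2 - (y * + 2 + x)) * + 2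
  weight-a = solve-∀
  weight-b : ∀ x y → ((x - 0ℤ) * (1ℤ - 0ℤ) - (y - 0ℤ) * (0ℤ - 0ℤ)) * + 2 ≡ x * + 2
  weight-b = solve-∀
  weight-c : ∀ x y → ((+ 2 - 0ℤ) * (y - 0ℤ) - (0ℤ - 0ℤ) * (x - 0ℤ)) * + 2 ≡ y * + 4
  weight-c = solve-∀
  lattice-points : ∀ x y → 0ℤ ≤ x → 0ℤ ≤ y → y * + 2 + x ≤ + 2 →
    (x , y) ≡ (0ℤ , 0ℤ) ⊎ (x , y) ≡ (+ 2 , 0ℤ) ⊎ (x , y) ≡ (0ℤ , 1ℤ) ⊎ (x , y) ≡ (1ℤ , 0ℤ)
  lattice-points (+ 0) (+ 0) _ _ _ = inj₁ refl
  lattice-points (+ 2) (+ 0) _ _ _ = inj₂ (inj₁ refl)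
  lattice-points (+ 0) (+ 1) _ _ _ = inj₂ (inj₂ (inj₁ refl))
  lattice-points (+ 1) (+ 0) _ _ _ = inj₂ (inj₂ (inj₂ refl))
  lattice-points (+ suc (suc (suc _))) (+ 0) _ _ (+≤+ (s≤s (s≤s ())))
  lattice-points (+ suc _) (+ 1) _ _ (+≤+ (s≤s (s≤s ())))
  lattice-points (+ _) (+ suc (suc _)) _ _ (+≤+ (s≤s (s≤s ())))

unimodular-borderTriangle : ∀ o u v → Unimodular u v →
  IsBorderTriangle (affine o u v (0ℤ , 0ℤ)) (affine o u v (+ 2 , 0ℤ))
                   (affine o u v (0ℤ , 1ℤ)) (affine o u v (1ℤ , 0ℤ))
unimodular-borderTriangle o u v unimodular =
  UnimodularAffine.isBorderTriangle⁺ o u v unimodular standard-borderTriangle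

module _ (S : Subset) (stable : BStable S) {a b c d : Point} (border : IsBorderTriangle a b c d) where

  fill-a : S b ≡ true → S c ≡ true → S d ≡ true → S a ≡ true
  fill-a sb sc sd with S a in sa | stable a b c d border
  ... | true  | _  = refl
  ... | false | ≢3 rewrite sb | sc | sd = ⊥-elim (≢3 refl)

  fill-b : S a ≡ true → S c ≡ true → S d ≡ true → S b ≡ true
  fill-b sa sc sd with S b in sb | stable a b c d border
  ... | true  | _  = refl
  ... | false | ≢3 rewrite sa | sc | sd = ⊥-elim (≢3 refl)

  fill-c : S a ≡ true → S b ≡ true → S d ≡ true → S c ≡ true
  fill-c sa sb sd with S c in sc | stable a b c d border
  ... | true  | _  = refl
  ... | false | ≢3 rewrite sa | sb | sd = ⊥-elim (≢3 refl)

  fill-d : S a ≡ true → S b ≡ true → S c ≡ true → S d ≡ true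
  fill-d sa sb sc with S d in sd | stable a b c d border
  ... | true  | _  = refl
  ... | false | ≢3 rewrite sa | sb | sc = ⊥-elim (≢3 refl)

e₁ e₂ : Point
e₁ = 1ℤ , 0ℤ
e₂ = 0ℤ , 1ℤ

shift-x shift-y : ℤ → Point → Point
shift-x k (x , y) = k + x , y
shift-y k (x , y) = x , k + y

shift-x-affine : ∀ k p → shift-x k p ≡ affine (k , 0ℤ) e₁ e₂ p
shift-x-affine k (x , y) = cong₂ _,_ (component₁ k x y) (component₂ x y)
  where
  component₁ : ∀ k x y → k + x ≡ k + (x * 1ℤ + y * 0ℤ)
  component₁ = solve-∀
  component₂ : ∀ x y → y ≡ 0ℤ + (x * 0ℤ + y * 1ℤ)
  component₂ = solve-∀

shift-y-affine : ∀ k p → shift-y k p ≡ affine (0ℤ , k) e₁ e₂ p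
shift-y-affine k (x , y) = cong₂ _,_ (component₁ x y) (component₂ k x y)
  where
  component₁ : ∀ x y → x ≡ 0ℤ + (x * 1ℤ + y * 0ℤ)
  component₁ = solve-∀
  component₂ : ∀ k x y → k + y ≡ k + (x * 0ℤ + y * 1ℤ)
  component₂ = solve-∀

bStable-shift-x : ∀ S k → BStable S → BStable (S ∘ shift-x k)
bStable-shift-x S k = UnimodularAffine.bStable-∘ (k , 0ℤ) e₁ e₂ refl S (shift-x k) (shift-x-affine k)

bStable-shift-y : ∀ S k → BStable S → BStable (S ∘ shift-y k)
bStable-shift-y S k = UnimodularAffine.bStable-∘ (0ℤ , k) e₁ e₂ refl S (shift-y k) (shift-y-affine k)

ContainsUnitTriangle : Subset → Set
ContainsUnitTriangle S = S (0ℤ , 0ℤ) ≡ true × S (1ℤ , 0ℤ) ≡ true × S (0ℤ , 1ℤ) ≡ true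

module _ (S : Subset) (stable : BStable S) where

  step-right : ContainsUnitTriangle S → ContainsUnitTriangle (S ∘ shift-x 1ℤ)
  step-right (s₀₀ , s₁₀ , s₀₁) = s₁₀ , s₂₀ , s₁₁
    where
    s₂₀ : S (+ 2 , 0ℤ) ≡ true
    s₂₀ = fill-b S stable (unimodular-borderTriangle (0ℤ , 0ℤ) e₁ e₂ refl) s₀₀ s₀₁ s₁₀
    s₁₁ : S (1ℤ , 1ℤ) ≡ true
    s₁₁ = fill-c S stable (unimodular-borderTriangle (0ℤ , 0ℤ) e₁ (1ℤ , 1ℤ) refl) s₀₀ s₂₀ s₁₀

  step-left : ContainsUnitTriangle S → ContainsUnitTriangle (S ∘ shift-x -1ℤ)
  step-left (s₀₀ , s₁₀ , s₀₁) = s₋₁₀ , s₀₀ , s₋₁₁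
    where
    s₋₁₀ : S (-1ℤ , 0ℤ) ≡ true
    s₋₁₀ = fill-a S stable (unimodular-borderTriangle (-1ℤ , 0ℤ) e₁ (1ℤ , 1ℤ) refl) s₁₀ s₀₁ s₀₀
    s₋₁₁ : S (-1ℤ , 1ℤ) ≡ true
    s₋₁₁ = fill-c S stable (unimodular-borderTriangle (-1ℤ , 0ℤ) e₁ e₂ refl) s₋₁₀ s₁₀ s₀₀

  step-up : ContainsUnitTriangle S → ContainsUnitTriangle (S ∘ shift-y 1ℤ)
  step-up (s₀₀ , s₁₀ , s₀₁) = s₀₁ , s₁₁ , s₀₂
    where
    s₀₂ : S (0ℤ , + 2) ≡ true
    s₀₂ = fill-b S stable (unimodular-borderTriangle (0ℤ , 0ℤ) e₂ e₁ refl) s₀₀ s₁₀ s₀₁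
    s₁₁ : S (1ℤ , 1ℤ) ≡ true
    s₁₁ = fill-c S stable (unimodular-borderTriangle (0ℤ , 0ℤ) e₂ (1ℤ , 1ℤ) refl) s₀₀ s₀₂ s₀₁

  step-down : ContainsUnitTriangle S → ContainsUnitTriangle (S ∘ shift-y -1ℤ)
  step-down (s₀₀ , s₁₀ , s₀₁) = s₀₋₁ , s₁₋₁ , s₀₀
    where
    s₀₋₁ : S (0ℤ , -1ℤ) ≡ true
    s₀₋₁ = fill-a S stable (unimodular-borderTriangle (0ℤ , -1ℤ) e₂ (1ℤ , 1ℤ) refl) s₀₁ s₁₀ s₀₀
    s₁₋₁ : S (1ℤ , -1ℤ) ≡ true
    s₁₋₁ = fill-c S stable (unimodular-borderTriangle (0ℤ , -1ℤ) e₂ e₁ refl) s₀₋₁ s₀₁ s₀₀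

-- 1ℤ + + n and -1ℤ + -[1+ n ] reduce to + suc n and -[1+ suc n ], so each
-- recursive call moves one step along an axis by shifting S.
unitTriangle⇒y-axis : ∀ S → BStable S → ContainsUnitTriangle S → ∀ y → S (0ℤ , y) ≡ true
unitTriangle⇒y-axis S stable unit (+ zero) = proj₁ unit
unitTriangle⇒y-axis S stable unit (+ suc n) =
  unitTriangle⇒y-axis (S ∘ shift-y 1ℤ) (bStable-shift-y S 1ℤ stable) (step-up S stable unit) (+ n)
unitTriangle⇒y-axis S stable unit -[1+ zero ] = proj₁ (step-down S stable unit)
unitTriangle⇒y-axis S stable unit -[1+ suc n ] =
  unitTriangle⇒y-axis (S ∘ shift-y -1ℤ) (bStable-shift-y S -1ℤ stable) (step-down S stable unit) -[1+ n ]

unitTriangle⇒full : ∀ S → BStable S → ContainsUnitTriangle S → ∀ p → S p ≡ true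
unitTriangle⇒full S stable unit (+ zero , y) = unitTriangle⇒y-axis S stable unit y
unitTriangle⇒full S stable unit (+ suc n , y) =
  unitTriangle⇒full (S ∘ shift-x 1ℤ) (bStable-shift-x S 1ℤ stable) (step-right S stable unit) (+ n , y)
unitTriangle⇒full S stable unit (-[1+ zero ] , y) =
  unitTriangle⇒y-axis (S ∘ shift-x -1ℤ) (bStable-shift-x S -1ℤ stable) (step-left S stable unit) y
unitTriangle⇒full S stable unit (-[1+ suc n ] , y) =
  unitTriangle⇒full (S ∘ shift-x -1ℤ) (bStable-shift-x S -1ℤ stable) (step-left S stable unit) (-[1+ n ] , y)

Triple : Set
Triple = Point × Point × Point

-- Three of the four points of standard-borderTriangle; the fourth 3-subset,
-- (2,0) (0,1) (1,0), is again a unimodular triangle.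
data Shape : Set where
  triangle line apex : Shape

corners : Shape → Triple
corners triangle = (0ℤ , 0ℤ) , (1ℤ , 0ℤ) , (0ℤ , 1ℤ)
corners line     = (0ℤ , 0ℤ) , (1ℤ , 0ℤ) , (+ 2 , 0ℤ)
corners apex     = (0ℤ , 0ℤ) , (+ 2 , 0ℤ) , (0ℤ , 1ℤ)

Frame : Set
Frame = Point × Point × Point

image : Frame → Triple → Triple
image (o , u , v) (a , b , c) = affine o u v a , affine o u v b , affine o u v c

Realises : Triple → Shape × Frame → Set
Realises t (σ , o , u , v) = Unimodular u v × image (o , u , v) (corners σ) ≡ t

Forbidden : Point → Point → Point → Set
Forbidden p q r = ∃ (Realises (p , q , r))

forbidden⇒full : ∀ S → BStable S → ∀ {p q r} → Forbidden p q r →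
  S p ≡ true → S q ≡ true → S r ≡ true → ∀ z → S z ≡ true
forbidden⇒full S stable ((σ , o , u , v) , unimodular , refl) sp sq sr z =
  subst (λ w → S w ≡ true) (affine-coordinates z)
    (unitTriangle⇒full (S ∘ φ) stable∘φ (unit σ sp sq sr) (coordinates z))
  where
  open UnimodularAffine o u v unimodular
  stable∘φ : BStable (S ∘ φ)
  stable∘φ = bStable-∘ S φ (λ _ → refl) stable
  unit : ∀ σ → let (a , b , c) = corners σ in
    S (φ a) ≡ true → S (φ b) ≡ true → S (φ c) ≡ true → ContainsUnitTriangle (S ∘ φ)
  unit triangle s₀₀ s₁₀ s₀₁ = s₀₀ , s₁₀ , s₀₁
  unit line s₀₀ s₁₀ s₂₀ =
    s₀₀ , s₁₀ , fill-c (S ∘ φ) stable∘φ standard-borderTriangle s₀₀ s₂₀ s₁₀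
  unit apex s₀₀ s₂₀ s₀₁ =
    s₀₀ , fill-d (S ∘ φ) stable∘φ standard-borderTriangle s₀₀ s₂₀ s₀₁ , s₀₁

module RussianDoll {Clash : Point → Point → Point → Set} (clash? : ∀ p q r → Dec (Clash p q r)) where

  ClashFree : Subset → Set
  ClashFree S = ∀ {p q r} → S p ≡ true → S q ≡ true → S r ≡ true → ¬ Clash p q r

  Bounded : List Point → ℕ → Set
  Bounded xs b = ∀ S → ClashFree S → countIn S xs ℕ.≤ b

  Clashes : Point → List Point → Set
  Clashes x [] = ⊥
  Clashes x (q ∷ qs) = Any (Clash x q) qs ⊎ Clashes x qs

  clashes? : ∀ x qs → Dec (Clashes x qs)
  clashes? x [] = no id
  clashes? x (q ∷ qs) = any? (clash? x q) qs ⊎-dec clashes? x qs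

  clashes-impossible : ∀ {S} → ClashFree S → ∀ {x} qs →
    S x ≡ true → All (λ p → S p ≡ true) qs → ¬ Clashes x qs
  clashes-impossible free (q ∷ qs) sx (sq ∷ sqs) (inj₁ clash) =
    All¬⇒¬Any (All.map (free sx sq) sqs) clash
  clashes-impossible free (q ∷ qs) sx (_ ∷ sqs) (inj₂ clashes) =
    clashes-impossible free qs sx sqs clashes

  -- Each point carries a claimed bound for the suffix of the list that it starts.
  Doll : Set
  Doll = List (Point × ℕ)

  points : Doll → List Point
  points = map proj₁

  bound : Doll → ℕ
  bound [] = 0
  bound ((_ , b) ∷ _) = b

  Certified : Doll → Set
  Certified [] = ⊤
  Certified ((x , b) ∷ d) = Bounded (x ∷ points d) b × Certified d

  bound-certified : ∀ d → Certified d → Bounded (points d) (bound d)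
  bound-certified [] _ S _ = z≤n
  bound-certified (_ ∷ _) (bounded , _) = bounded

  fits : ℕ → List Point → Doll → Bool
  fits t chosen [] = length chosen ≤ᵇ t
  fits t chosen ((x , b) ∷ d) =
    (length chosen ℕ.+ b ≤ᵇ t) ∨
    ((isYes (clashes? x chosen) ∨ fits t (x ∷ chosen) d) ∧ fits t chosen d)

  fits-sound : ∀ {t} chosen d → Certified d → T (fits t chosen d) →
    ∀ S → ClashFree S → All (λ p → S p ≡ true) chosen →
    length chosen ℕ.+ countIn S (points d) ℕ.≤ t
  fits-sound {t} chosen [] _ fit S _ _ =
    subst (ℕ._≤ t) (sym (+-identityʳ (length chosen))) (≤ᵇ⇒≤ _ _ fit)
  fits-sound {t} chosen ((x , b) ∷ d) (bounded , certified) fit S free in-S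
    with Equivalence.to T-∨ fit
  ... | inj₁ pruned = ≤-trans (+-monoʳ-≤ (length chosen) (bounded S free)) (≤ᵇ⇒≤ _ _ pruned)
  ... | inj₂ branches with Equivalence.to T-∧ branches | S x in sx
  ...   | _ , without-x | false = fits-sound chosen d certified without-x S free in-S
  ...   | with-x , _ | true with Equivalence.to T-∨ with-x
  ...     | inj₁ clash =
    ⊥-elim (clashes-impossible free chosen sx in-S (toWitness {a? = clashes? x chosen} clash))
  ...     | inj₂ fit′ =
    subst (ℕ._≤ t) (sym (+-suc (length chosen) (countIn S (points d))))
      (fits-sound (x ∷ chosen) d certified fit′ S free (sx ∷ in-S))

  push : Point → Doll → Doll
  push x d = (x , (if fits (bound d) (x ∷ []) d then bound d else suc (bound d))) ∷ d

  push-certified : ∀ x d → Certified d → Certified (push x d)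
  push-certified x d certified = bounded , certified
    where
    bounded : Bounded (x ∷ points d) (if fits (bound d) (x ∷ []) d then bound d else suc (bound d))
    bounded S free with fits (bound d) (x ∷ []) d in fit | S x in sx
    ... | true  | true  = fits-sound (x ∷ []) d certified (Equivalence.from T-≡ fit) S free (sx ∷ [])
    ... | true  | false = bound-certified d certified S free
    ... | false | true  = s≤s (bound-certified d certified S free)
    ... | false | false = m≤n⇒m≤1+n (bound-certified d certified S free)

  doll : List Point → Doll
  doll = foldr push []

  doll-certified : ∀ xs → Certified (doll xs)
  doll-certified [] = tt
  doll-certified (x ∷ xs) = push-certified x (doll xs) (doll-certified xs)

  points-doll : ∀ xs → points (doll xs) ≡ xs
  points-doll [] = refl
  points-doll (x ∷ xs) = cong (x ∷_) (points-doll xs)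

  -- Phrased with an equation so that the search is evaluated once, when that
  -- equation is checked, rather than again in conversion checks.
  doll-bounded : ∀ xs {b} → bound (doll xs) ≡ b → Bounded xs b
  doll-bounded xs refl =
    subst (λ ys → Bounded ys (bound (doll xs))) (points-doll xs)
      (bound-certified (doll xs) (doll-certified xs))

realises? : ∀ t c → Dec (Realises t c)
realises? t (σ , o , u , v) =
  (det u v * det u v ℤ.≟ 1ℤ) ×-dec ≡-dec _≟ᵖ_ (≡-dec _≟ᵖ_ _≟ᵖ_) (image (o , u , v) (corners σ)) t
  where
  _≟ᵖ_ : (p q : Point) → Dec (p ≡ q)
  _≟ᵖ_ = ≡-dec ℤ._≟_ ℤ._≟_

half : Point → Point
half (a , b) = a / + 2 , b / + 2

-- Missing a forbidden triple here cannot make the final bound unsound, only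
-- larger, so the candidate frames are merely good guesses, checked by realises?.
candidates : Triple → List (Shape × Frame)
candidates (p , q , r) =
  (triangle , p , q ⊖ p , r ⊖ p) ∷
  (line , p , q ⊖ p , e₁) ∷
  (line , p , q ⊖ p , e₂) ∷
  (apex , p , half (q ⊖ p) , r ⊖ p) ∷ []

Detected : Triple → Set
Detected t = Any (Realises t) (candidates t)

-- The rotations let each of the three points be the midpoint of a line or the apex.
Detectable : Point → Point → Point → Set
Detectable p q r = Detected (p , q , r) ⊎ Detected (q , r , p) ⊎ Detected (r , p , q)

detectable? : ∀ p q r → Dec (Detectable p q r)
detectable? p q r = detected? (p , q , r) ⊎-dec detected? (q , r , p) ⊎-dec detected? (r , p , q)
  where
  detected? : ∀ t → Dec (Detected t)
  detected? t = any? (realises? t) (candidates t)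

open RussianDoll using (ClashFree; doll-bounded)

proper⇒clashFree : ∀ S → Proper S → BStable S → ClashFree detectable? S
proper⇒clashFree S (z , sz≡false) stable {p} {q} {r} sp sq sr detectable =
  not-¬ (full detectable) sz≡false
  where
  full : Detectable p q r → S z ≡ true
  full (inj₁ d) = forbidden⇒full S stable (satisfied d) sp sq sr z
  full (inj₂ (inj₁ d)) = forbidden⇒full S stable (satisfied d) sq sr sp z
  full (inj₂ (inj₂ d)) = forbidden⇒full S stable (satisfied d) sr sp sq z

lemma3p4 : (S : Subset) → Proper S → BStable S → countIn S grid6 ℕ.≤ 9
lemma3p4 S proper stable = doll-bounded detectable? grid6 refl S (proper⇒clashFree S proper stable)
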